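{- Let $g\geq 1$. Every oriented maximal Wicks form of genus $g$ has exactly $2(g-1)$ positive vertices and exactly $2g$ negative vertices.
   Context: An oriented Wicks form is a cyclic word $w=w_1\cdots w_{2l}$ over an alphabet $a_1^{\pm1},a_2^{\pm1},\dots$ such that: (1) if $a_i^{\epsilon}$ appears, then $a_i^{ -\epsilon}$ appears exactly once; (2) there is no cyclic factor $a_ia_i^{ -1}$ or $a_i^{ -1}a_i$; (3) if $a_i^{\epsilon}a_j^{\delta}$ is a cyclic factor, then $a_j^{ -\delta}a_i^{ -\epsilon}$ is not. Gluing a $2l$-gon in the oriented plane, labelled and oriented according to $w$, gives a closed oriented surface $S$ (whose genus is the genus of $w$) carrying a graph $\Gamma$. The edges of $\Gamma$ are the letter pairs $\{a_i,a_i^{ -1}\}$, and the vertices are the classes of identified polygon corners, the corners being the positions between cyclically consecutive letters. The form is maximal if its length is $6(2g-1)$; then $\Gamma$ has $2(2g-1)$ vertices, all of degree $3$. Let $V$ be a vertex with its three edges $a,b,c$ oriented toward $V$. Then $V$ is positive if $w=ab^{ -1}\cdots bc^{ -1}\cdots ca^{ -1}\cdots$ or $w=ac^{ -1}\cdots cb^{ -1}\cdots ba^{ -1}\cdots$ (as cyclic words). It is negative if $w=ab^{ -1}\cdots ca^{ -1}\cdots bc^{ -1}\cdots$ or $w=ac^{ -1}\cdots ba^{ -1}\cdots cb^{ -1}\cdots$. -}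

module Defs where

open import Data.Nat using (ℕ; zero; suc; _+_; _*_)
open import Data.Nat.DivMod using (_mod_)
open import Data.Bool using (Bool; not)
open import Data.Fin using (Fin; toℕ; _<_)
open import Data.Product using (Σ; Σ-syntax; ∃; ∃-syntax; _×_; _,_)
open import Data.Sum using (_⊎_)
open import Data.Unit using (⊤)
open import Relation.Nullary using (¬_)
open import Relation.Binary.PropositionalEquality using (_≡_; _≢_)
open import Relation.Binary.Construct.Closure.Equivalence using (EqClosure)

-- A letter a_i^ε : index i and sign ε (true = +1, false = -1).
Letter : Set
Letter = ℕ × Bool

inv : Letter → Letter
inv (i , ε) = (i , not ε)

-- A cyclic word of length n is represented by any linear representative
-- w : Fin n → Letter; all notions below are invariant under rotation.
Word : ℕ → Set
Word n = Fin n → Letter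

next : ∀ {n} → Fin n → Fin n
next {suc m} i = suc (toℕ i) mod suc m

module _ {n : ℕ} (w : Word n) where

  Cond1 : Set
  Cond1 = ∀ p → Σ[ q ∈ Fin n ] (w q ≡ inv (w p) × (∀ q′ → w q′ ≡ inv (w p) → q′ ≡ q))

  Cond2 : Set
  Cond2 = ∀ p → w (next p) ≢ inv (w p)

  Cond3 : Set
  Cond3 = ∀ p q → ¬ (w q ≡ inv (w (next p)) × w (next q) ≡ inv (w p))

  IsOrientedWicksForm : Set
  IsOrientedWicksForm = Cond1 × Cond2 × Cond3

  -- Corners: corner p is the position between w_p and w_{p+1}
  -- (cyclically); it is the terminal point of w_p and the initial point
  -- of w_{p+1}.  Gluing the edge w_p with its inverse occurrence
  -- w_{q+1} = w_p⁻¹ identifies the terminal point of w_p (corner p) with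
  -- the initial point of w_{q+1} (corner q).
  Glue : Fin n → Fin n → Set
  Glue p q = w (next q) ≡ inv (w p)

  SameVertex : Fin n → Fin n → Set
  SameVertex = EqClosure Glue

  -- "The set of vertices satisfying P has exactly m elements":
  -- P is a predicate on corners (meant to be invariant under SameVertex);
  -- we ask for m representatives, pairwise in different vertices,
  -- covering every corner satisfying P.
  NumVerticesWith : (Fin n → Set) → ℕ → Set
  NumVerticesWith P m =
    Σ[ f ∈ (Fin m → Fin n) ]
      ((∀ i → P (f i))
      × (∀ i j → SameVertex (f i) (f j) → i ≡ j)
      × (∀ p → P p → ∃[ i ] SameVertex p (f i)))

  NumVertices : ℕ → Set
  NumVertices = NumVerticesWith (λ _ → ⊤)

  -- Genus via the Euler characteristic of the glued surface:
  -- 2 - 2g = V - E + F with E = n/2 edges and F = 1 face,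
  -- i.e. 2V + 4g = n + 2.
  HasGenus : ℕ → Set
  HasGenus g = Σ[ V ∈ ℕ ] (NumVertices V × 2 * V + 4 * g ≡ n + 2)

  CyclicOrder : Fin n → Fin n → Fin n → Set
  CyclicOrder i j k = (i < j × j < k) ⊎ (j < k × k < i) ⊎ (k < i × i < j)

  -- w = x y⁻¹ ⋯ y z⁻¹ ⋯ z x⁻¹ ⋯  (cyclically), with the factor x y⁻¹
  -- starting at position i, i.e. at corner i.  Here x = w_i, y = w_j, z = w_k
  -- are the edges oriented toward the vertex.
  Pattern : Fin n → Fin n → Fin n → Set
  Pattern i j k =
    CyclicOrder i j k
    × w (next i) ≡ inv (w j)
    × w (next j) ≡ inv (w k)
    × w (next k) ≡ inv (w i)

  -- The vertex of corner p is positive: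
  -- w = ab⁻¹ ⋯ bc⁻¹ ⋯ ca⁻¹ ⋯  or  w = ac⁻¹ ⋯ cb⁻¹ ⋯ ba⁻¹ ⋯
  -- where a, b, c are the edges oriented toward that vertex
  -- (the corners ab⁻¹ etc. are corners at that vertex).
  PositiveAt : Fin n → Set
  PositiveAt p =
    Σ[ i ∈ Fin n ] Σ[ j ∈ Fin n ] Σ[ k ∈ Fin n ]
      (SameVertex p i
      × (Pattern i j k            -- a = w_i, b = w_j, c = w_k
        ⊎ Pattern i k j))         -- a = w_i, c = w_k, b = w_j

  -- The vertex of corner p is negative:
  -- w = ab⁻¹ ⋯ ca⁻¹ ⋯ bc⁻¹ ⋯  or  w = ac⁻¹ ⋯ ba⁻¹ ⋯ cb⁻¹ ⋯
  NegPattern : Fin n → Fin n → Fin n → Set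
  NegPattern i j k =
    -- a = w_i, b = w_j, c = w_k; corners: i (a b⁻¹), k (c a⁻¹), j (b c⁻¹)
    CyclicOrder i k j
    × w (next i) ≡ inv (w j)
    × w (next j) ≡ inv (w k)
    × w (next k) ≡ inv (w i)

  NegativeAt : Fin n → Set
  NegativeAt p =
    Σ[ i ∈ Fin n ] Σ[ j ∈ Fin n ] Σ[ k ∈ Fin n ]
      (SameVertex p i
      × (NegPattern i j k ⊎ NegPattern i k j))

-- Number the corners 0 … N-1, corner p lying between the letters w_p and w_{p+1}.  Let ι send
-- a position to that of the inverse letter and let σ p be the corner just before ι p: gluing
-- identifies corner p with corner σ p, so the vertices are the σ-orbits.  Conditions (2) and (3)
-- forbid orbits of size 1 and 2, and maximality gives N = 3V, so every vertex has exactly three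
-- corners and σ³ = 1.  The corners p, σ p, σ² p of a vertex contain two descents (σ q < q) if the
-- vertex is positive and one if it is negative, so the number D of descents of σ satisfies
-- 3D = N + P, where P is the number of corners at positive vertices.  On the other hand σ p < p
-- iff ι p < p, except at the single p with ι p = 0, and the involution ι has N/2 descents, so
-- D = N/2 - 1.  Hence P = (N - 6)/2; counting ascents instead, the negative vertices have
-- (N + 6)/2 corners.  Dividing by 3 with N = 6(2g - 1) gives 2(g - 1) and 2g vertices.

module Submission where

open import Defs
open import Data.Nat using (ℕ; _≤_; _*_; _∸_)
open import Data.Fin using (Fin)
open import Data.Product using (_×_)
open import Relation.Binary.PropositionalEquality using (_≡_)

open import Data.Bool.Base using (true; false; if_then_else_)
open import Data.Empty using (⊥; ⊥-elim)
open import Data.Fin.Base using (zero; suc; _<_; toℕ; fromℕ; inject₁)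
open import Data.Fin.Permutation using (permutation)
open import Data.Fin.Properties
  using (_≟_; _<?_; <-trans; <-asym; <-cmp; ≤∧≢⇒<; ≤fromℕ; suc-injective; injective⇒≤;
         toℕ-injective; toℕ-fromℕ<; toℕ-fromℕ; toℕ-inject₁; toℕ<n)
open import Data.Fin.Relation.Unary.Top using (view; ‵fromℕ; ‵inject₁)
open import Data.Nat.Base using (zero; suc; _+_; z≤n; s<s)
open import Data.Nat.DivMod using (_%_; n%n≡0; m<n⇒m%n≡m)
open import Data.Nat.Properties
  using (0≢1+n; <-irrefl; <⇒≤; <⇒≱; m≤n⇒m<n∨m≡n; +-comm; +-identityʳ; +-mono-≤; +-mono-<-≤;
         +-cancelˡ-≡; +-cancelʳ-≡; *-comm; *-assoc; *-identityˡ; *-identityʳ; *-cancelˡ-≡; +-*-semiring)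
open import Algebra.Properties.Semiring.Sum +-*-semiring
  using (sum; sum-syntax; sum-cong-≗; ∑-distrib-+; ∑-comm; ∑-permute; *-distribˡ-sum; *-distribʳ-sum; sum-replicate-zero)
open import Data.Nat.Solver using (module +-*-Solver)
open +-*-Solver using (solve; _:+_; _:*_; _:=_; con)
open import Data.Product using (∃-syntax; _,_; proj₁; proj₂)
open import Data.Sum using (inj₁; inj₂; [_,_])
open import Data.Unit using (tt)
open import Data.Vec.Base using (Vec; lookup; []; _∷_)
open import Data.Vec.Relation.Unary.All using (All; []; _∷_)
open import Data.Vec.Relation.Unary.All.Properties using (lookup⁺)
open import Data.Vec.Relation.Unary.Unique.Propositional using (Unique; []; _∷_)
open import Data.Vec.Relation.Unary.Unique.Propositional.Properties using (lookup-injective)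
open import Function.Base using (_∘_)
open import Function.Bundles using (_⇔_; mk⇔; Equivalence)
open import Function.Definitions using (Injective)
open import Level using (Level)
open import Relation.Binary.Construct.Closure.ReflexiveTransitive using (ε; _◅_; _◅◅_)
open import Relation.Binary.Construct.Closure.Symmetric using (fwd; bwd)
import Relation.Binary.Construct.Closure.Equivalence as EqClosure
open import Relation.Binary.Definitions using (tri<; tri≈; tri>)
open import Relation.Binary.PropositionalEquality
  using (_≢_; _≗_; ≢-sym; refl; sym; trans; cong; cong₂; subst; module ≡-Reasoning)
open import Relation.Nullary using (Dec; yes; no; does; ¬_)
open import Relation.Nullary.Decidable using (_×-dec_; _⊎-dec_)
open import Relation.Unary using (Pred; Decidable)

private
  variable
    ℓ ℓ₁ ℓ₂ ℓ₃ : Level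
    A : Set ℓ₁
    B : Set ℓ₂
    C : Set ℓ₃
    k n : ℕ

-- Iverson brackets and finite sums

iverson : Dec A → ℕ
iverson a? = if does a? then 1 else 0

iverson-yes : (a? : Dec A) → A → iverson a? ≡ 1
iverson-yes (yes _) _ = refl
iverson-yes (no ¬a) a = ⊥-elim (¬a a)

iverson-no : (a? : Dec A) → ¬ A → iverson a? ≡ 0
iverson-no (yes a) ¬a = ⊥-elim (¬a a)
iverson-no (no _) _ = refl

iverson-cong : (a? : Dec A) (b? : Dec B) → (A → B) → (B → A) → iverson a? ≡ iverson b?
iverson-cong (yes a) b? a→b _ = sym (iverson-yes b? (a→b a))
iverson-cong (no ¬a) b? _ b→a = sym (iverson-no b? (¬a ∘ b→a))

iverson-+-exclusive : (a? : Dec A) (b? : Dec B) →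
  ¬ (A × B) → (¬ A → ¬ B → ⊥) → iverson a? + iverson b? ≡ 1
iverson-+-exclusive (yes a) (yes b) ¬both _ = ⊥-elim (¬both (a , b))
iverson-+-exclusive (yes _) (no _) _ _ = refl
iverson-+-exclusive (no _) (yes _) _ _ = refl
iverson-+-exclusive (no ¬a) (no ¬b) _ ¬none = ⊥-elim (¬none ¬a ¬b)

iverson-+-majority : (a? : Dec A) (b? : Dec B) (c? : Dec C) →
  ¬ (A × B × C) → (¬ A → ¬ B → ¬ C → ⊥) →
  iverson a? + iverson b? + iverson c? ≡
  1 + iverson ((a? ×-dec b?) ⊎-dec (b? ×-dec c?) ⊎-dec (c? ×-dec a?))
iverson-+-majority (yes a) (yes b) (yes c) ¬all _ = ⊥-elim (¬all (a , b , c))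
iverson-+-majority (yes _) (yes _) (no _)  _ _ = refl
iverson-+-majority (yes _) (no _)  (yes _) _ _ = refl
iverson-+-majority (no _)  (yes _) (yes _) _ _ = refl
iverson-+-majority (yes _) (no _)  (no _)  _ _ = refl
iverson-+-majority (no _)  (yes _) (no _)  _ _ = refl
iverson-+-majority (no _)  (no _)  (yes _) _ _ = refl
iverson-+-majority (no ¬a) (no ¬b) (no ¬c) _ ¬none = ⊥-elim (¬none ¬a ¬b ¬c)

∑-const : ∀ n c → ∑[ i < n ] c ≡ n * c
∑-const zero c = refl
∑-const (suc n) c = cong (c +_) (∑-const n c)

∑-ones : ∀ n → ∑[ i < n ] 1 ≡ n
∑-ones n = trans (∑-const n 1) (*-identityʳ n)

∑-mono-≤ : {f g : Fin n → ℕ} → (∀ i → f i ≤ g i) → sum f ≤ sum g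
∑-mono-≤ {zero} _ = z≤n
∑-mono-≤ {suc n} f≤g = +-mono-≤ (f≤g zero) (∑-mono-≤ (f≤g ∘ suc))

+-≤∧≡⇒≡ : ∀ {x y u v} → x ≤ y → u ≤ v → x + u ≡ y + v → x ≡ y × u ≡ v
+-≤∧≡⇒≡ x≤y u≤v eq with m≤n⇒m<n∨m≡n x≤y
... | inj₁ x<y = ⊥-elim (<-irrefl eq (+-mono-<-≤ x<y u≤v))
... | inj₂ refl = refl , +-cancelˡ-≡ _ _ _ eq

∑-≤∧≡⇒≗ : {f g : Fin n → ℕ} → (∀ i → f i ≤ g i) → sum f ≡ sum g → f ≗ g
∑-≤∧≡⇒≗ {suc n} f≤g eq i with +-≤∧≡⇒≡ (f≤g zero) (∑-mono-≤ (f≤g ∘ suc)) eq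
∑-≤∧≡⇒≗ {suc n} f≤g eq zero | head≡ , _ = head≡
∑-≤∧≡⇒≗ {suc n} f≤g eq (suc i) | _ , tail≡ = ∑-≤∧≡⇒≗ (f≤g ∘ suc) tail≡ i

∑-reindex : (π π⁻¹ : Fin n → Fin n) → (∀ i → π (π⁻¹ i) ≡ i) → (∀ i → π⁻¹ (π i) ≡ i) →
  (f : Fin n → ℕ) → ∑[ i < n ] f (π i) ≡ sum f
∑-reindex π π⁻¹ π∘π⁻¹ π⁻¹∘π f = sym (∑-permute f (permutation π π⁻¹ π∘π⁻¹ π⁻¹∘π))

∑-δ-* : (j : Fin n) (y : Fin n → ℕ) → ∑[ i < n ] (iverson (j ≟ i) * y i) ≡ y j
∑-δ-* {suc n} zero y = trans (cong₂ _+_ (*-identityˡ (y zero)) (sum-replicate-zero n)) (+-identityʳ (y zero))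
∑-δ-* {suc n} (suc j) y = ∑-δ-* j (y ∘ suc)

∑-δ : (j : Fin n) → ∑[ i < n ] iverson (j ≟ i) ≡ 1
∑-δ {n} j = trans (sum-cong-≗ {n} (λ i → sym (*-identityʳ _))) (∑-δ-* j (λ _ → 1))

count : {P : Pred (Fin n) ℓ} → Decidable P → ℕ
count {n} P? = ∑[ p < n ] iverson (P? p)

∑-fibre-sizes : (h : Fin n → Fin k) → ∑[ i < k ] count (λ p → h p ≟ i) ≡ n
∑-fibre-sizes {n} {k} h = begin
  ∑[ i < k ] ∑[ p < n ] iverson (h p ≟ i)  ≡⟨ ∑-comm (λ i p → iverson (h p ≟ i)) ⟩
  ∑[ p < n ] ∑[ i < k ] iverson (h p ≟ i)  ≡⟨ sum-cong-≗ (∑-δ ∘ h) ⟩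
  ∑[ p < n ] 1                             ≡⟨ ∑-ones n ⟩
  n                                        ∎
  where open ≡-Reasoning

∑-∘-fibres : (h : Fin n → Fin k) (y : Fin k → ℕ) →
  ∑[ p < n ] y (h p) ≡ ∑[ i < k ] (count (λ p → h p ≟ i) * y i)
∑-∘-fibres {n} {k} h y = begin
  ∑[ p < n ] y (h p)                                ≡⟨ sum-cong-≗ (λ p → sym (∑-δ-* (h p) y)) ⟩
  ∑[ p < n ] ∑[ i < k ] (iverson (h p ≟ i) * y i)   ≡⟨ ∑-comm (λ p i → iverson (h p ≟ i) * y i) ⟩
  ∑[ i < k ] ∑[ p < n ] (iverson (h p ≟ i) * y i)   ≡⟨ sum-cong-≗ (λ i → sym (*-distribʳ-sum {n} (y i) (λ p → iverson (h p ≟ i)))) ⟩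
  ∑[ i < k ] (count (λ p → h p ≟ i) * y i)          ∎
  where open ≡-Reasoning

record Enumeration {n} (P : Pred (Fin n) ℓ) (k : ℕ) : Set ℓ where
  field
    element : Fin k → Fin n
    element-injective : Injective _≡_ _≡_ element
    element-sound : ∀ i → P (element i)
    element-complete : ∀ {p} → P p → ∃[ i ] element i ≡ p

enumerate : {P : Pred (Fin n) ℓ} (P? : Decidable P) → Enumeration P (count P?)
enumerate {zero} P? = record
  { element = λ ()
  ; element-injective = λ { {()} }
  ; element-sound = λ ()
  ; element-complete = λ { {()} }
  }
enumerate {suc n} {P = P} P? = extend (P? zero) (enumerate (P? ∘ suc))
  where
  extend : ∀ {k} (P₀? : Dec (P zero)) → Enumeration (P ∘ suc) k → Enumeration P (iverson P₀? + k)
  extend (yes P₀) E = record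
    { element = λ { zero → zero ; (suc i) → suc (element i) }
    ; element-injective = λ
        { {zero} {zero} _ → refl
        ; {suc i} {suc j} eq → cong suc (element-injective (suc-injective eq))
        }
    ; element-sound = λ { zero → P₀ ; (suc i) → element-sound i }
    ; element-complete = λ
        { {zero} _ → zero , refl
        ; {suc p} Pp → let i , eq = element-complete Pp in suc i , cong suc eq
        }
    }
    where open Enumeration E
  extend (no ¬P₀) E = record
    { element = suc ∘ element
    ; element-injective = element-injective ∘ suc-injective
    ; element-sound = element-sound
    ; element-complete = λ
        { {zero} P₀ → ⊥-elim (¬P₀ P₀)
        ; {suc p} Pp → let i , eq = element-complete Pp in i , cong suc eq
        }
    }
    where open Enumeration E

Unique∧All⇒≤count : {P : Pred (Fin n) ℓ} (P? : Decidable P) {xs : Vec (Fin n) k} →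
  Unique xs → All P xs → k ≤ count P?
Unique∧All⇒≤count P? {xs} distinct Pxs = injective⇒≤ index-injective
  where
  open Enumeration (enumerate P?)
  index : Fin _ → Fin (count P?)
  index j = proj₁ (element-complete (lookup⁺ Pxs j))
  index-injective : Injective _≡_ _≡_ index
  index-injective {i} {j} eq = lookup-injective distinct i j (begin
    lookup xs i            ≡⟨ sym (proj₂ (element-complete (lookup⁺ Pxs i))) ⟩
    element (index i)      ≡⟨ cong element eq ⟩
    element (index j)      ≡⟨ proj₂ (element-complete (lookup⁺ Pxs j)) ⟩
    lookup xs j            ∎)
    where open ≡-Reasoning

-- Linear and cyclic order on Fin

≮∧≢⇒> : {i j : Fin n} → ¬ i < j → i ≢ j → j < i
≮∧≢⇒> {i = i} {j} i≮j i≢j with <-cmp i j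
... | tri< i<j _ _ = ⊥-elim (i≮j i<j)
... | tri≈ _ i≡j _ = ⊥-elim (i≢j i≡j)
... | tri> _ _ j<i = j<i

iverson-<-+-> : {i j : Fin n} → i ≢ j → iverson (i <? j) + iverson (j <? i) ≡ 1
iverson-<-+-> {i = i} {j} i≢j =
  iverson-+-exclusive (i <? j) (j <? i) (λ (i<j , j<i) → <-asym i<j j<i)
    (λ i≮j j≮i → j≮i (≮∧≢⇒> i≮j i≢j))

module _ (w : Word n) where

  cyclicOrder? : ∀ i j k → Dec (CyclicOrder w i j k)
  cyclicOrder? i j k = (i <? j ×-dec j <? k) ⊎-dec (j <? k ×-dec k <? i) ⊎-dec (k <? i ×-dec i <? j)

  cyclicOrder-rotate : ∀ {i j k} → CyclicOrder w i j k → CyclicOrder w k i j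
  cyclicOrder-rotate (inj₁ ijk) = inj₂ (inj₁ ijk)
  cyclicOrder-rotate (inj₂ (inj₁ jki)) = inj₂ (inj₂ jki)
  cyclicOrder-rotate (inj₂ (inj₂ kij)) = inj₁ kij

  ascents-around-triangle : ∀ {i j k} → i ≢ j → j ≢ k → k ≢ i →
    iverson (i <? j) + iverson (j <? k) + iverson (k <? i) ≡ 1 + iverson (cyclicOrder? i j k)
  ascents-around-triangle {i} {j} {k} i≢j j≢k k≢i =
    iverson-+-majority (i <? j) (j <? k) (k <? i) no-ascending-cycle no-descending-cycle
    where
    no-ascending-cycle : ¬ (i < j × j < k × k < i)
    no-ascending-cycle (i<j , j<k , k<i) = <-asym (<-trans i<j j<k) k<i
    no-descending-cycle : ¬ i < j → ¬ j < k → ¬ k < i → ⊥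
    no-descending-cycle i≮j j≮k k≮i =
      <-asym (<-trans (≮∧≢⇒> k≮i k≢i) (≮∧≢⇒> j≮k j≢k)) (≮∧≢⇒> i≮j i≢j)

module _ {m : ℕ} where

  prev : Fin (suc m) → Fin (suc m)
  prev zero = fromℕ m
  prev (suc j) = inject₁ j

  toℕ-next : (i : Fin (suc m)) → toℕ (next i) ≡ suc (toℕ i) % suc m
  toℕ-next i = toℕ-fromℕ< _

  next-fromℕ : next (fromℕ m) ≡ zero
  next-fromℕ = toℕ-injective (begin
    toℕ (next (fromℕ m))     ≡⟨ toℕ-next (fromℕ m) ⟩
    suc (toℕ (fromℕ m)) % suc m  ≡⟨ cong (λ t → suc t % suc m) (toℕ-fromℕ m) ⟩
    suc m % suc m            ≡⟨ n%n≡0 (suc m) ⟩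
    0                        ∎)
    where open ≡-Reasoning

  next-inject₁ : (j : Fin m) → next (inject₁ j) ≡ suc j
  next-inject₁ j = toℕ-injective (begin
    toℕ (next (inject₁ j))         ≡⟨ toℕ-next (inject₁ j) ⟩
    suc (toℕ (inject₁ j)) % suc m  ≡⟨ cong (λ t → suc t % suc m) (toℕ-inject₁ j) ⟩
    suc (toℕ j) % suc m            ≡⟨ m<n⇒m%n≡m (s<s (toℕ<n j)) ⟩
    suc (toℕ j)                    ∎)
    where open ≡-Reasoning

  next-prev : (i : Fin (suc m)) → next (prev i) ≡ i
  next-prev zero = next-fromℕ
  next-prev (suc j) = next-inject₁ j

  prev-next : (i : Fin (suc m)) → prev (next i) ≡ i
  prev-next i with view i
  ... | ‵fromℕ = cong prev next-fromℕ
  ... | ‵inject₁ j = cong prev (next-inject₁ j)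

  iverson-prev-< : (i p : Fin (suc m)) → i ≢ p →
    iverson (prev i <? p) + iverson (zero ≟ i) ≡ iverson (i <? p)
  iverson-prev-< zero p 0≢p =
    trans (cong (_+ 1) (iverson-no (fromℕ m <? p) (λ m<p → <⇒≱ m<p (≤fromℕ p))))
          (sym (iverson-yes (zero {m} <? p) (≤∧≢⇒< z≤n 0≢p)))
  iverson-prev-< (suc j) p 1+j≢p =
    trans (+-identityʳ _) (iverson-cong (inject₁ j <? p) (suc j <? p) strengthen weaken)
    where
    strengthen : inject₁ j < p → suc j < p
    strengthen j<p = ≤∧≢⇒< (subst (λ t → suc t ≤ toℕ p) (toℕ-inject₁ j) j<p) 1+j≢p
    weaken : suc j < p → inject₁ j < p
    weaken 1+j<p = subst (λ t → suc t ≤ toℕ p) (sym (toℕ-inject₁ j)) (<⇒≤ 1+j<p)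

-- Linear arithmetic for the vertex counts

positives-from-descents : ∀ {N D P} → 2 * D + 2 ≡ N → 3 * D ≡ N + P → 2 * P + 6 ≡ N
positives-from-descents {N} {D} {P} 2D+2≡N 3D≡N+P = +-cancelʳ-≡ (2 * N) _ _ (begin
  2 * P + 6 + 2 * N   ≡⟨ solve 2 (λ n p → con 2 :* p :+ con 6 :+ con 2 :* n := con 2 :* (n :+ p) :+ con 6) refl N P ⟩
  2 * (N + P) + 6     ≡⟨ cong (λ t → 2 * t + 6) 3D≡N+P ⟨
  2 * (3 * D) + 6     ≡⟨ solve 1 (λ d → con 2 :* (con 3 :* d) :+ con 6 := con 3 :* (con 2 :* d :+ con 2)) refl D ⟩
  3 * (2 * D + 2)     ≡⟨ cong (3 *_) 2D+2≡N ⟩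
  3 * N               ≡⟨ solve 1 (λ n → con 3 :* n := n :+ con 2 :* n) refl N ⟩
  N + 2 * N           ∎)
  where open ≡-Reasoning

negatives-from-ascents : ∀ {N D A Q} → 2 * D + 2 ≡ N → D + A ≡ N → 3 * A ≡ N + Q → 2 * Q ≡ N + 6
negatives-from-ascents {N} {D} {A} {Q} 2D+2≡N D+A≡N 3A≡N+Q = +-cancelʳ-≡ (5 * N) _ _ (begin
  2 * Q + 5 * N                    ≡⟨ solve 2 (λ n q → con 2 :* q :+ con 5 :* n := con 2 :* (n :+ q) :+ con 3 :* n) refl N Q ⟩
  2 * (N + Q) + 3 * N              ≡⟨ cong₂ (λ s t → 2 * s + 3 * t) 3A≡N+Q 2D+2≡N ⟨
  2 * (3 * A) + 3 * (2 * D + 2)    ≡⟨ solve 2 (λ d a → con 2 :* (con 3 :* a) :+ con 3 :* (con 2 :* d :+ con 2) := con 6 :* (d :+ a) :+ con 6) refl D A ⟩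
  6 * (D + A) + 6                  ≡⟨ cong (λ t → 6 * t + 6) D+A≡N ⟩
  6 * N + 6                        ≡⟨ solve 1 (λ n → con 6 :* n :+ con 6 := n :+ con 6 :+ con 5 :* n) refl N ⟩
  N + 6 + 5 * N                    ∎)
  where open ≡-Reasoning

genus-corners : ∀ h → 6 * (2 * suc h ∸ 1) ≡ 12 * h + 6
genus-corners h = trans
  (cong (λ t → 6 * (t ∸ 1)) (solve 1 (λ h → con 2 :* (con 1 :+ h) := con 2 :+ con 2 :* h) refl h))
  (solve 1 (λ h → con 6 :* (con 1 :+ con 2 :* h) := con 12 :* h :+ con 6) refl h)

corners≡3*vertices : ∀ {n V h} → 2 * V + 4 * suc h ≡ n + 2 → n ≡ 12 * h + 6 → n ≡ 3 * V
corners≡3*vertices {n} {V} {h} euler n≡ = begin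
  n                ≡⟨ n≡ ⟩
  12 * h + 6       ≡⟨ solve 1 (λ h → con 12 :* h :+ con 6 := con 3 :* (con 4 :* h :+ con 2)) refl h ⟩
  3 * (4 * h + 2)  ≡⟨ cong (3 *_) V≡ ⟨
  3 * V            ∎
  where
  open ≡-Reasoning
  V≡ : V ≡ 4 * h + 2
  V≡ = *-cancelˡ-≡ V (4 * h + 2) 2 (+-cancelʳ-≡ (4 * suc h) _ _ (begin
    2 * V + 4 * suc h              ≡⟨ euler ⟩
    n + 2                          ≡⟨ cong (_+ 2) n≡ ⟩
    12 * h + 6 + 2                 ≡⟨ solve 1 (λ h → con 12 :* h :+ con 6 :+ con 2 := con 2 :* (con 4 :* h :+ con 2) :+ con 4 :* (con 1 :+ h)) refl h ⟩
    2 * (4 * h + 2) + 4 * suc h    ∎))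

-- Corners and vertices of an oriented Wicks form

inv-involutive : ∀ x → inv (inv x) ≡ x
inv-involutive (_ , true) = refl
inv-involutive (_ , false) = refl

inv-swap : ∀ {x y} → x ≡ inv y → y ≡ inv x
inv-swap {x} {y} x≡y⁻¹ = trans (sym (inv-involutive y)) (cong inv (sym x≡y⁻¹))

inv-≢ : ∀ x → inv x ≢ x
inv-≢ (_ , true) ()
inv-≢ (_ , false) ()

module OrientedWicksForm {m : ℕ} (w : Word (suc m)) (wicks : IsOrientedWicksForm w) where

  ι : Fin (suc m) → Fin (suc m)
  ι p = proj₁ (proj₁ wicks p)

  w-ι : ∀ p → w (ι p) ≡ inv (w p)
  w-ι p = proj₁ (proj₂ (proj₁ wicks p))

  ι-unique : ∀ {p q} → w q ≡ inv (w p) → q ≡ ι p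
  ι-unique {p} {q} = proj₂ (proj₂ (proj₁ wicks p)) q

  ι-involutive : ∀ p → ι (ι p) ≡ p
  ι-involutive p = sym (ι-unique (inv-swap (w-ι p)))

  ι-no-fixed-point : ∀ p → ι p ≢ p
  ι-no-fixed-point p ιp≡p = inv-≢ (w p) (trans (sym (w-ι p)) (cong w ιp≡p))

  σ : Fin (suc m) → Fin (suc m)
  σ p = prev (ι p)

  glue-σ : ∀ p → Glue w p (σ p)
  glue-σ p = trans (cong w (next-prev (ι p))) (w-ι p)

  glue⇒≡σ : ∀ {p q} → Glue w p q → q ≡ σ p
  glue⇒≡σ {p} {q} glue = trans (sym (prev-next q)) (cong prev (ι-unique glue))

  σ-no-fixed-point : ∀ p → σ p ≢ p
  σ-no-fixed-point p σp≡p = proj₁ (proj₂ wicks) p (subst (λ q → w (next q) ≡ inv (w p)) σp≡p (glue-σ p))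

  σ²-no-fixed-point : ∀ p → σ (σ p) ≢ p
  σ²-no-fixed-point p σ²p≡p = proj₂ (proj₂ wicks) p (σ p) (inv-swap glue-σp-p , glue-σ p)
    where
    glue-σp-p : Glue w (σ p) p
    glue-σp-p = subst (Glue w (σ p)) σ²p≡p (glue-σ (σ p))

  sameVertex-σ : ∀ p → SameVertex w p (σ p)
  sameVertex-σ p = fwd (glue-σ p) ◅ ε

  descents : ℕ
  descents = ∑[ p < suc m ] iverson (σ p <? p)

  ι-descents : ℕ
  ι-descents = ∑[ p < suc m ] iverson (ι p <? p)

  ι-descents-half : ι-descents + ι-descents ≡ suc m
  ι-descents-half = begin
    ι-descents + ι-descents                              ≡⟨ cong (ι-descents +_) ι-ascents≡ι-descents ⟨
    ι-descents + ∑[ p < suc m ] iverson (p <? ι p)       ≡⟨ ∑-distrib-+ (λ p → iverson (ι p <? p)) (λ p → iverson (p <? ι p)) ⟨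
    ∑[ p < suc m ] (iverson (ι p <? p) + iverson (p <? ι p))
                                                         ≡⟨ sum-cong-≗ (iverson-<-+-> ∘ ι-no-fixed-point) ⟩
    ∑[ p < suc m ] 1                                     ≡⟨ ∑-ones (suc m) ⟩
    suc m                                                ∎
    where
    open ≡-Reasoning
    ι-ascents≡ι-descents : ∑[ p < suc m ] iverson (p <? ι p) ≡ ι-descents
    ι-ascents≡ι-descents = trans (sym (∑-reindex ι ι ι-involutive ι-involutive (λ q → iverson (q <? ι q))))
                       (sum-cong-≗ (λ p → cong (λ q → iverson (ι p <? q)) (ι-involutive p)))

  descents+1≡ι-descents : descents + 1 ≡ ι-descents
  descents+1≡ι-descents = begin
    descents + 1                                         ≡⟨ cong (descents +_) wraps≡1 ⟨
    descents + ∑[ p < suc m ] iverson (zero ≟ ι p)       ≡⟨ ∑-distrib-+ (λ p → iverson (σ p <? p)) (λ p → iverson (zero ≟ ι p)) ⟨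
    ∑[ p < suc m ] (iverson (σ p <? p) + iverson (zero ≟ ι p))
                                                         ≡⟨ sum-cong-≗ (λ p → iverson-prev-< (ι p) p (ι-no-fixed-point p)) ⟩
    ι-descents                                           ∎
    where
    open ≡-Reasoning
    wraps≡1 : ∑[ p < suc m ] iverson (zero ≟ ι p) ≡ 1
    wraps≡1 = trans (∑-reindex ι ι ι-involutive ι-involutive (λ q → iverson (zero ≟ q))) (∑-δ (zero {m}))

  2*descents+2 : 2 * descents + 2 ≡ suc m
  2*descents+2 = begin
    2 * descents + 2                 ≡⟨ solve 1 (λ d → con 2 :* d :+ con 2 := d :+ con 1 :+ (d :+ con 1)) refl descents ⟩
    descents + 1 + (descents + 1)    ≡⟨ cong₂ _+_ descents+1≡ι-descents descents+1≡ι-descents ⟩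
    ι-descents + ι-descents          ≡⟨ ι-descents-half ⟩
    suc m                            ∎
    where open ≡-Reasoning

  module Trivalent {V : ℕ} (vertices : NumVertices w V) (corners≡3V : suc m ≡ 3 * V) where

    rep : Fin V → Fin (suc m)
    rep = proj₁ vertices

    rep-separated : ∀ i j → SameVertex w (rep i) (rep j) → i ≡ j
    rep-separated = proj₁ (proj₂ (proj₂ vertices))

    vertexOf : Fin (suc m) → Fin V
    vertexOf p = proj₁ (proj₂ (proj₂ (proj₂ vertices)) p tt)

    sameVertex-rep : ∀ p → SameVertex w p (rep (vertexOf p))
    sameVertex-rep p = proj₂ (proj₂ (proj₂ (proj₂ vertices)) p tt)

    vertexOf-resp : ∀ {p q} → SameVertex w p q → vertexOf p ≡ vertexOf q
    vertexOf-resp {p} {q} p~q =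
      rep-separated _ _ (EqClosure.symmetric (Glue w) (sameVertex-rep p) ◅◅ p~q ◅◅ sameVertex-rep q)

    vertexOf-rep : ∀ i → vertexOf (rep i) ≡ i
    vertexOf-rep i = rep-separated _ _ (EqClosure.symmetric (Glue w) (sameVertex-rep (rep i)))

    vertexOf-σ : ∀ p → vertexOf (σ p) ≡ vertexOf p
    vertexOf-σ p = sym (vertexOf-resp (sameVertex-σ p))

    degree : Fin V → ℕ
    degree i = count (λ p → vertexOf p ≟ i)

    vertexOf-σ² : ∀ p → vertexOf (σ (σ p)) ≡ vertexOf p
    vertexOf-σ² p = trans (vertexOf-σ (σ p)) (vertexOf-σ p)

    degree≥3 : ∀ i → 3 ≤ degree i
    degree≥3 i = subst (λ j → 3 ≤ degree j) (vertexOf-rep i)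
      (Unique∧All⇒≤count (λ q → vertexOf q ≟ vertexOf p) distinct (refl ∷ vertexOf-σ p ∷ vertexOf-σ² p ∷ []))
      where
      p : Fin (suc m)
      p = rep i
      distinct : Unique (p ∷ σ p ∷ σ (σ p) ∷ [])
      distinct = (≢-sym (σ-no-fixed-point p) ∷ ≢-sym (σ²-no-fixed-point p) ∷ [])
               ∷ (≢-sym (σ-no-fixed-point (σ p)) ∷ [])
               ∷ [] ∷ []

    degree≡3 : ∀ i → degree i ≡ 3
    degree≡3 i = sym (∑-≤∧≡⇒≗ degree≥3 ∑3≡∑degree i)
      where
      open ≡-Reasoning
      ∑3≡∑degree : ∑[ i < V ] 3 ≡ sum degree
      ∑3≡∑degree = begin
        ∑[ i < V ] 3     ≡⟨ ∑-const V 3 ⟩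
        V * 3            ≡⟨ *-comm V 3 ⟩
        3 * V            ≡⟨ corners≡3V ⟨
        suc m            ≡⟨ ∑-fibre-sizes vertexOf ⟨
        sum degree       ∎

    σ³≡id : ∀ p → σ (σ (σ p)) ≡ p
    σ³≡id p with σ (σ (σ p)) ≟ p
    ... | yes σ³p≡p = σ³p≡p
    ... | no σ³p≢p = ⊥-elim (<-irrefl refl (subst (4 ≤_) (degree≡3 (vertexOf p)) degree≥4))
      where
      distinct : Unique (p ∷ σ p ∷ σ (σ p) ∷ σ (σ (σ p)) ∷ [])
      distinct = (≢-sym (σ-no-fixed-point p) ∷ ≢-sym (σ²-no-fixed-point p) ∷ ≢-sym σ³p≢p ∷ [])
               ∷ (≢-sym (σ-no-fixed-point (σ p)) ∷ ≢-sym (σ²-no-fixed-point (σ p)) ∷ [])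
               ∷ (≢-sym (σ-no-fixed-point (σ (σ p))) ∷ [])
               ∷ [] ∷ []
      degree≥4 : 4 ≤ degree (vertexOf p)
      degree≥4 = Unique∧All⇒≤count (λ q → vertexOf q ≟ vertexOf p) distinct
        (refl ∷ vertexOf-σ p ∷ vertexOf-σ² p ∷ trans (vertexOf-σ (σ (σ p))) (vertexOf-σ² p) ∷ [])

    glue⇒σ²≡ : ∀ {p q} → Glue w q p → σ (σ p) ≡ q
    glue⇒σ²≡ {p} {q} glue = trans (cong (σ ∘ σ) (glue⇒≡σ glue)) (σ³≡id q)

    σ-closed⇒resp : {X : Fin (suc m) → Set ℓ} → (∀ p → X p → X (σ p)) →
      ∀ {p q} → SameVertex w p q → X p → X q
    σ-closed⇒resp closed ε x = x
    σ-closed⇒resp {X = X} closed (fwd glue ◅ p~q) x =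
      σ-closed⇒resp closed p~q (subst X (sym (glue⇒≡σ glue)) (closed _ x))
    σ-closed⇒resp {X = X} closed (bwd glue ◅ p~q) x =
      σ-closed⇒resp closed p~q (subst X (glue⇒σ²≡ glue) (closed _ (closed _ x)))

    PositiveCorner NegativeCorner : Fin (suc m) → Set
    PositiveCorner p = CyclicOrder w p (σ (σ p)) (σ p)
    NegativeCorner p = CyclicOrder w p (σ p) (σ (σ p))

    positive? : Decidable PositiveCorner
    positive? p = cyclicOrder? w p (σ (σ p)) (σ p)

    negative? : Decidable NegativeCorner
    negative? p = cyclicOrder? w p (σ p) (σ (σ p))

    positive-σ : ∀ p → PositiveCorner p → PositiveCorner (σ p)
    positive-σ p pos = subst (λ q → CyclicOrder w (σ p) q (σ (σ p))) (sym (σ³≡id p)) (cyclicOrder-rotate w pos)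

    negative-σ : ∀ p → NegativeCorner p → NegativeCorner (σ p)
    negative-σ p neg = subst (CyclicOrder w (σ p) (σ (σ p))) (sym (σ³≡id p)) (cyclicOrder-rotate w (cyclicOrder-rotate w neg))

    glue-triangle : ∀ {i j k} → Glue w j i → Glue w k j → Glue w i k → k ≡ σ i × j ≡ σ (σ i)
    glue-triangle {i} {j} {k} _ glue-kj glue-ik = k≡σi , trans (glue⇒≡σ glue-kj) (cong σ k≡σi)
      where
      k≡σi : k ≡ σ i
      k≡σi = glue⇒≡σ glue-ik

    pattern⇒positive : ∀ {i j k} → Pattern w i j k → PositiveCorner i
    pattern⇒positive (order , glue-ji , glue-kj , glue-ik) with glue-triangle glue-ji glue-kj glue-ik
    ... | refl , refl = order

    negPattern⇒negative : ∀ {i j k} → NegPattern w i j k → NegativeCorner i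
    negPattern⇒negative (order , glue-ji , glue-kj , glue-ik) with glue-triangle glue-ji glue-kj glue-ik
    ... | refl , refl = order

    glue-σ² : ∀ p → Glue w (σ (σ p)) p
    glue-σ² p = subst (Glue w (σ (σ p))) (σ³≡id p) (glue-σ (σ (σ p)))

    positiveAt⇔ : ∀ p → PositiveAt w p ⇔ PositiveCorner p
    positiveAt⇔ p = mk⇔
      (λ (_ , _ , _ , p~i , shape) → σ-closed⇒resp positive-σ (EqClosure.symmetric (Glue w) p~i)
                                        ([ pattern⇒positive , pattern⇒positive ] shape))
      (λ pos → p , σ (σ p) , σ p , ε , inj₁ (pos , glue-σ² p , glue-σ (σ p) , glue-σ p))

    negativeAt⇔ : ∀ p → NegativeAt w p ⇔ NegativeCorner p
    negativeAt⇔ p = mk⇔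
      (λ (_ , _ , _ , p~i , shape) → σ-closed⇒resp negative-σ (EqClosure.symmetric (Glue w) p~i)
                                        ([ negPattern⇒negative , negPattern⇒negative ] shape))
      (λ neg → p , σ (σ p) , σ p , ε , inj₁ (neg , glue-σ² p , glue-σ (σ p) , glue-σ p))

    verticesWith : {X A : Fin (suc m) → Set} (X? : Decidable X) → (∀ p → X p → X (σ p)) →
      (∀ p → A p ⇔ X p) → NumVerticesWith w A (count (X? ∘ rep))
    verticesWith {A = A} X? closed A⇔X =
      rep ∘ element , (λ i → Equivalence.from (A⇔X _) (element-sound i)) , separated , complete
      where
      open Enumeration (enumerate (X? ∘ rep))
      separated : ∀ i j → SameVertex w (rep (element i)) (rep (element j)) → i ≡ j
      separated i j = element-injective ∘ rep-separated (element i) (element j)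
      complete : ∀ p → A p → ∃[ i ] SameVertex w p (rep (element i))
      complete p a with element-complete (σ-closed⇒resp closed (sameVertex-rep p) (Equivalence.to (A⇔X p) a))
      ... | i , element-i≡ = i , subst (SameVertex w p ∘ rep) (sym element-i≡) (sameVertex-rep p)

    count≡3*vertexCount : {X : Fin (suc m) → Set} (X? : Decidable X) → (∀ p → X p → X (σ p)) →
      count X? ≡ 3 * count (X? ∘ rep)
    count≡3*vertexCount X? closed = begin
      count X?                                           ≡⟨ sum-cong-≗ X-at-rep ⟩
      ∑[ p < suc m ] iverson (X? (rep (vertexOf p)))     ≡⟨ ∑-∘-fibres vertexOf (iverson ∘ X? ∘ rep) ⟩
      ∑[ i < V ] (degree i * iverson (X? (rep i)))       ≡⟨ sum-cong-≗ (λ i → cong (_* iverson (X? (rep i))) (degree≡3 i)) ⟩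
      ∑[ i < V ] (3 * iverson (X? (rep i)))              ≡⟨ *-distribˡ-sum 3 (iverson ∘ X? ∘ rep) ⟨
      3 * count (X? ∘ rep)                               ∎
      where
      open ≡-Reasoning
      X-at-rep : ∀ p → iverson (X? p) ≡ iverson (X? (rep (vertexOf p)))
      X-at-rep p = iverson-cong (X? p) (X? (rep (vertexOf p)))
        (σ-closed⇒resp closed (sameVertex-rep p))
        (σ-closed⇒resp closed (EqClosure.symmetric (Glue w) (sameVertex-rep p)))

    ∑-σ : (y : Fin (suc m) → ℕ) → ∑[ p < suc m ] y (σ p) ≡ sum y
    ∑-σ = ∑-reindex σ (σ ∘ σ) σ³≡id σ³≡id

    ∑-around-vertex : (y : Fin (suc m) → ℕ) → ∑[ p < suc m ] (y p + y (σ p) + y (σ (σ p))) ≡ 3 * sum y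
    ∑-around-vertex y = begin
      ∑[ p < suc m ] (y p + y (σ p) + y (σ (σ p)))     ≡⟨ ∑-distrib-+ (λ p → y p + y (σ p)) (y ∘ σ ∘ σ) ⟩
      ∑[ p < suc m ] (y p + y (σ p)) + ∑[ p < suc m ] y (σ (σ p))
                                                       ≡⟨ cong₂ _+_ (∑-distrib-+ y (y ∘ σ)) (trans (∑-σ (y ∘ σ)) (∑-σ y)) ⟩
      sum y + ∑[ p < suc m ] y (σ p) + sum y           ≡⟨ cong (λ t → sum y + t + sum y) (∑-σ y) ⟩
      sum y + sum y + sum y                            ≡⟨ solve 1 (λ s → s :+ s :+ s := con 3 :* s) refl (sum y) ⟩
      3 * sum y                                        ∎
      where open ≡-Reasoning

    descents-around-vertex : ∀ p →
      iverson (σ p <? p) + iverson (σ (σ p) <? σ p) + iverson (σ (σ (σ p)) <? σ (σ p)) ≡ 1 + iverson (positive? p)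
    descents-around-vertex p = begin
      d₁ + d₂ + iverson (σ (σ (σ p)) <? σ (σ p))  ≡⟨ cong (λ q → d₁ + d₂ + iverson (q <? σ (σ p))) (σ³≡id p) ⟩
      d₁ + d₂ + d₃                                ≡⟨ solve 3 (λ x y z → x :+ y :+ z := z :+ y :+ x) refl d₁ d₂ d₃ ⟩
      d₃ + d₂ + d₁                                ≡⟨ ascents-around-triangle w (≢-sym (σ²-no-fixed-point p)) (σ-no-fixed-point (σ p)) (σ-no-fixed-point p) ⟩
      1 + iverson (positive? p)                   ∎
      where
      open ≡-Reasoning
      d₁ d₂ d₃ : ℕ
      d₁ = iverson (σ p <? p)
      d₂ = iverson (σ (σ p) <? σ p)
      d₃ = iverson (p <? σ (σ p))

    ascents-around-vertex : ∀ p →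
      iverson (p <? σ p) + iverson (σ p <? σ (σ p)) + iverson (σ (σ p) <? σ (σ (σ p))) ≡ 1 + iverson (negative? p)
    ascents-around-vertex p =
      trans (cong (λ q → iverson (p <? σ p) + iverson (σ p <? σ (σ p)) + iverson (σ (σ p) <? q)) (σ³≡id p))
            (ascents-around-triangle w (≢-sym (σ-no-fixed-point p)) (≢-sym (σ-no-fixed-point (σ p))) (σ²-no-fixed-point p))

    ascents : ℕ
    ascents = ∑[ p < suc m ] iverson (p <? σ p)

    descents+ascents : descents + ascents ≡ suc m
    descents+ascents = begin
      descents + ascents                                             ≡⟨ ∑-distrib-+ (λ p → iverson (σ p <? p)) (λ p → iverson (p <? σ p)) ⟨
      ∑[ p < suc m ] (iverson (σ p <? p) + iverson (p <? σ p))       ≡⟨ sum-cong-≗ (iverson-<-+-> ∘ σ-no-fixed-point) ⟩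
      ∑[ p < suc m ] 1                                               ≡⟨ ∑-ones (suc m) ⟩
      suc m                                                          ∎
      where open ≡-Reasoning

    3*descents : 3 * descents ≡ suc m + count positive?
    3*descents = begin
      3 * descents                                      ≡⟨ ∑-around-vertex (λ p → iverson (σ p <? p)) ⟨
      ∑[ p < suc m ] (iverson (σ p <? p) + iverson (σ (σ p) <? σ p) + iverson (σ (σ (σ p)) <? σ (σ p)))
                                                        ≡⟨ sum-cong-≗ descents-around-vertex ⟩
      ∑[ p < suc m ] (1 + iverson (positive? p))        ≡⟨ ∑-distrib-+ (λ _ → 1) (iverson ∘ positive?) ⟩
      ∑[ p < suc m ] 1 + count positive?                ≡⟨ cong (_+ count positive?) (∑-ones (suc m)) ⟩
      suc m + count positive?                           ∎
      where open ≡-Reasoning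

    3*ascents : 3 * ascents ≡ suc m + count negative?
    3*ascents = begin
      3 * ascents                                       ≡⟨ ∑-around-vertex (λ p → iverson (p <? σ p)) ⟨
      ∑[ p < suc m ] (iverson (p <? σ p) + iverson (σ p <? σ (σ p)) + iverson (σ (σ p) <? σ (σ (σ p))))
                                                        ≡⟨ sum-cong-≗ ascents-around-vertex ⟩
      ∑[ p < suc m ] (1 + iverson (negative? p))        ≡⟨ ∑-distrib-+ (λ _ → 1) (iverson ∘ negative?) ⟩
      ∑[ p < suc m ] 1 + count negative?                ≡⟨ cong (_+ count negative?) (∑-ones (suc m)) ⟩
      suc m + count negative?                           ∎
      where open ≡-Reasoning

    6*positiveVertices+6 : 6 * count (positive? ∘ rep) + 6 ≡ suc m
    6*positiveVertices+6 = begin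
      6 * count (positive? ∘ rep) + 6        ≡⟨ cong (_+ 6) (*-assoc 2 3 (count (positive? ∘ rep))) ⟩
      2 * (3 * count (positive? ∘ rep)) + 6  ≡⟨ cong (λ t → 2 * t + 6) (count≡3*vertexCount positive? positive-σ) ⟨
      2 * count positive? + 6                ≡⟨ positives-from-descents {D = descents} 2*descents+2 3*descents ⟩
      suc m                                  ∎
      where open ≡-Reasoning

    6*negativeVertices : 6 * count (negative? ∘ rep) ≡ suc m + 6
    6*negativeVertices = begin
      6 * count (negative? ∘ rep)            ≡⟨ *-assoc 2 3 (count (negative? ∘ rep)) ⟩
      2 * (3 * count (negative? ∘ rep))      ≡⟨ cong (2 *_) (count≡3*vertexCount negative? negative-σ) ⟨
      2 * count negative?                    ≡⟨ negatives-from-ascents {D = descents} {A = ascents} 2*descents+2 descents+ascents 3*ascents ⟩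
      suc m + 6                              ∎
      where open ≡-Reasoning

proposition2p1 : (g : ℕ) → 1 ≤ g → (n : ℕ) (w : Word n) →
    IsOrientedWicksForm w → HasGenus w g → n ≡ 6 * (2 * g ∸ 1) →
    NumVerticesWith w (PositiveAt w) (2 * (g ∸ 1))
    × NumVerticesWith w (NegativeAt w) (2 * g)
proposition2p1 zero () _ _ _ _ _
proposition2p1 (suc h) _ zero _ _ _ 0≡ = ⊥-elim (0≢1+n (trans 0≡ (trans (genus-corners h) (+-comm (12 * h) 6))))
proposition2p1 (suc h) _ (suc m) w wicks (V , vertices , euler) n≡ =
    subst (NumVerticesWith w (PositiveAt w)) positives (verticesWith positive? positive-σ positiveAt⇔)
  , subst (NumVerticesWith w (NegativeAt w)) negatives (verticesWith negative? negative-σ negativeAt⇔)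
  where
  corners≡ : suc m ≡ 12 * h + 6
  corners≡ = trans n≡ (genus-corners h)
  open OrientedWicksForm w wicks
  open Trivalent vertices (corners≡3*vertices {V = V} euler corners≡)
  positives : count (positive? ∘ rep) ≡ 2 * h
  positives = *-cancelˡ-≡ _ _ 6
    (trans (+-cancelʳ-≡ 6 _ _ (trans 6*positiveVertices+6 corners≡)) (*-assoc 6 2 h))
  negatives : count (negative? ∘ rep) ≡ 2 * suc h
  negatives = *-cancelˡ-≡ _ _ 6 (trans 6*negativeVertices (trans (cong (_+ 6) corners≡)
    (solve 1 (λ h → con 12 :* h :+ con 6 :+ con 6 := con 6 :* (con 2 :* (con 1 :+ h))) refl h)))
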